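{- Let $p$ be an odd prime and let $c\in GF(p)\setminus\{0\}$ be a nonsquare if $p\equiv 1 \pmod 4$ and a nonzero square if $p\equiv 3\pmod 4$. For $k\in GF(p)\setminus\{0\}$ let $O_k\subset PG(2,p)$ be the conic $x^2+ky^2+ckz^2=0$. Let $\beta\in GF(p)\setminus\{0\}$ and $n\ge 3$. Then $O_1\diamond O_{\beta^2}$ and $(O_1,O_{\beta^2})$ has an $n$-sided Poncelet polygon if and only if $O_{\beta^{ -2}}\diamond O_1$ and $(O_{\beta^{ -2}},O_1)$ has an $n$-sided Poncelet polygon.
   Context: $PG(2,p)$ is the projective plane over $GF(p)$ with homogeneous coordinates. A tangent of a conic is a line meeting it in exactly one point; a point is an exterior point of a conic $O$ if exactly two tangents of $O$ pass through it; $O\diamond O'$ means every point of $O'$ is an exterior point of $O$. An $n$-sided Poncelet polygon for $(O_\alpha,O_\beta)$ is a cyclic sequence of $n$ distinct points $B_1,\dots,B_n\in O_\beta$ such that each line $B_iB_{i+1}$ ($B_{n+1}=B_1$) is a tangent of $O_\alpha$. -}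

module Defs where

open import Data.Nat using (ℕ; suc)
open import Data.Integer using (ℤ; +_; _+_; _-_; _*_)
open import Data.Integer.Divisibility using (_∣_)
open import Data.Fin using (Fin; toℕ)
open import Data.Product using (_×_; ∃; Σ; _,_)
open import Data.Sum using (_⊎_)
open import Relation.Binary.PropositionalEquality using (_≡_; _≢_)
open import Relation.Nullary using (¬_)

-- Arithmetic of GF(p), represented by integers modulo p.
infix 4 _≈[_]_
_≈[_]_ : ℤ → ℕ → ℤ → Set
a ≈[ p ] b = + p ∣ (a - b)

IsZero : ℕ → ℤ → Set
IsZero p a = a ≈[ p ] + 0

IsSquare : ℕ → ℤ → Set
IsSquare p a = ∃ λ (t : ℤ) → (t * t) ≈[ p ] a

-- Homogeneous coordinate triples (used both for points and for lines of PG(2,p)).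
V3 : Set
V3 = ℤ × ℤ × ℤ

IsPt : ℕ → V3 → Set
IsPt p (x , y , z) = ¬ (IsZero p x × IsZero p y × IsZero p z)

SamePt : ℕ → V3 → V3 → Set
SamePt p (x , y , z) (x' , y' , z') =
  ∃ λ (l : ℤ) → ¬ IsZero p l × ((l * x) ≈[ p ] x') × ((l * y) ≈[ p ] y') × ((l * z) ≈[ p ] z')

Inc : ℕ → V3 → V3 → Set
Inc p (a , b , c) (x , y , z) = ((a * x + b * y) + c * z) ≈[ p ] + 0

Conic : Set₁
Conic = V3 → Set

O : ℕ → ℤ → ℤ → Conic
O p c k (x , y , z) = ((x * x + k * (y * y)) + (c * k) * (z * z)) ≈[ p ] + 0

Tangent : ℕ → Conic → V3 → Set
Tangent p C L = IsPt p L × ∃ λ P → IsPt p P × Inc p L P × C P ×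
  ((Q : V3) → IsPt p Q → Inc p L Q → C Q → SamePt p Q P)

Exterior : ℕ → Conic → V3 → Set
Exterior p C P = ∃ λ L₁ → ∃ λ L₂ →
  Tangent p C L₁ × Tangent p C L₂ × Inc p L₁ P × Inc p L₂ P × ¬ SamePt p L₁ L₂ ×
  ((L : V3) → Tangent p C L → Inc p L P → SamePt p L L₁ ⊎ SamePt p L L₂)

Diamond : ℕ → Conic → Conic → Set
Diamond p C C' = (P : V3) → IsPt p P → C' P → Exterior p C P

CycNext : (n : ℕ) → Fin n → Fin n → Set
CycNext n i j = (suc (toℕ i) ≡ toℕ j) ⊎ ((suc (toℕ i) ≡ n) × (toℕ j ≡ 0))

HasPoncelet : ℕ → ℕ → Conic → Conic → Set
HasPoncelet p n Cα Cβ = Σ (Fin n → V3) λ B →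
  ((i : Fin n) → IsPt p (B i) × Cβ (B i)) ×
  ((i j : Fin n) → i ≢ j → ¬ SamePt p (B i) (B j)) ×
  ((i j : Fin n) → CycNext n i j →
     ∃ λ L → Tangent p Cα L × Inc p L (B i) × Inc p L (B j))

-- The collineation σ_β : (x:y:z) ↦ (x : βy : βz) sends O_{β²} onto
-- O₁ and O₁ onto O_{γ²}, because  x² + m(βy)² + cm(βz)² = x² + β²m y² + cβ²m z².
-- Its matrix diag(1,β,β) is symmetric, so lines transform by the inverse map
-- σ_γ and incidence is preserved; hence tangents, exterior points, the
-- ◇-relation and Poncelet polygons are all carried along, and σ_γ carries
-- everything back.
module Submission where

open import Defs
open import Data.Nat using (ℕ; _%_; _≤_)
open import Data.Nat.Primality using (Prime)
open import Data.Integer using (ℤ; +_; _*_; _+_; _-_; -_)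
open import Data.Integer.Tactic.RingSolver using (solve-∀)
open import Data.Product using (_×_; _,_; ∃; proj₁; proj₂)
open import Data.Sum using (inj₁; inj₂; _⊎_)
open import Function.Bundles using (_⇔_; mk⇔)
open import Relation.Binary.PropositionalEquality using (_≡_; refl; sym; subst)
open import Relation.Nullary using (¬_)
open import Data.Integer.Properties using (*-comm; *-identityʳ)
import Data.Integer.Divisibility.Signed as Signed

module _ {p : ℕ} where

  -- Congruence modulo p.  The record wrapper lets Agda infer both sides of
  -- a congruence, which the unfolded divisibility  p ∣ a - b  does not.

  infix 4 _≋_
  record _≋_ (a b : ℤ) : Set where
    constructor divides-difference
    field p∣a-b : + p Signed.∣ (a - b)

  ≋-intro : ∀ {a b} → a ≈[ p ] b → a ≋ b
  ≋-intro d = divides-difference (Signed.∣ᵤ⇒∣ d)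

  ≋-elim : ∀ {a b} → a ≋ b → a ≈[ p ] b
  ≋-elim (divides-difference d) = Signed.∣⇒∣ᵤ d

  ≋-refl : ∀ {a} → a ≋ a
  ≋-refl {a} = divides-difference (subst (+ p Signed.∣_) (a-a≡0 a) (Signed.divides (+ 0) refl))
    where
    a-a≡0 : ∀ a → + 0 ≡ a - a
    a-a≡0 = solve-∀

  ≋-reflexive : ∀ {a b} → a ≡ b → a ≋ b
  ≋-reflexive refl = ≋-refl

  ≋-sym : ∀ {a b} → a ≋ b → b ≋ a
  ≋-sym {a} {b} (divides-difference d) =
    divides-difference (subst (+ p Signed.∣_) (negate a b) (Signed.∣m⇒∣-m d))
    where
    negate : ∀ a b → - (a - b) ≡ b - a
    negate = solve-∀

  ≋-trans : ∀ {a b c} → a ≋ b → b ≋ c → a ≋ c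
  ≋-trans {a} {b} {c} (divides-difference d) (divides-difference e) =
    divides-difference (subst (+ p Signed.∣_) (telescope a b c) (Signed.∣m∣n⇒∣m+n d e))
    where
    telescope : ∀ a b c → (a - b) + (b - c) ≡ a - c
    telescope = solve-∀

  +-cong : ∀ {a b a' b'} → a ≋ a' → b ≋ b' → a + b ≋ a' + b'
  +-cong {a} {b} {a'} {b'} (divides-difference d) (divides-difference e) =
    divides-difference (subst (+ p Signed.∣_) (sum a b a' b') (Signed.∣m∣n⇒∣m+n d e))
    where
    sum : ∀ a b a' b' → (a - a') + (b - b') ≡ (a + b) - (a' + b')
    sum = solve-∀

  *-cong : ∀ {a b a' b'} → a ≋ a' → b ≋ b' → a * b ≋ a' * b'
  *-cong {a} {b} {a'} {b'} (divides-difference d) (divides-difference e) =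
    divides-difference (subst (+ p Signed.∣_) (product a b a' b')
      (Signed.∣m∣n⇒∣m+n (Signed.∣n⇒∣m*n b d) (Signed.∣n⇒∣m*n a' e)))
    where
    product : ∀ a b a' b' → b * (a - a') + a' * (b - b') ≡ a * b - a' * b'
    product = solve-∀

  *-congˡ : ∀ k {a a'} → a ≋ a' → k * a ≋ k * a'
  *-congˡ k = *-cong (≋-refl {k})

  infix 4 _~_
  data _~_ : V3 → V3 → Set where
    ~-intro : ∀ {x y z x' y' z'} → x ≋ x' → y ≋ y' → z ≋ z' → (x , y , z) ~ (x' , y' , z')

  ~-refl : ∀ P → P ~ P
  ~-refl (_ , _ , _) = ~-intro ≋-refl ≋-refl ≋-refl

  ~-sym : ∀ {P Q} → P ~ Q → Q ~ P
  ~-sym (~-intro x y z) = ~-intro (≋-sym x) (≋-sym y) (≋-sym z)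

  isPt-resp : ∀ {P P'} → P ~ P' → IsPt p P → IsPt p P'
  isPt-resp (~-intro x y z) pt (x'≡0 , y'≡0 , z'≡0) =
    pt ( ≋-elim (≋-trans x (≋-intro {b = + 0} x'≡0))
       , ≋-elim (≋-trans y (≋-intro {b = + 0} y'≡0))
       , ≋-elim (≋-trans z (≋-intro {b = + 0} z'≡0)))

  _·_ : V3 → V3 → ℤ
  (a , b , c) · (x , y , z) = (a * x + b * y) + c * z

  inc→ : ∀ L X → Inc p L X → L · X ≋ + 0
  inc→ (_ , _ , _) (_ , _ , _) i = ≋-intro i

  →inc : ∀ L X → L · X ≋ + 0 → Inc p L X
  →inc (_ , _ , _) (_ , _ , _) i = ≋-elim i

  ·-cong : ∀ {L L' X X'} → L ~ L' → X ~ X' → L · X ≋ L' · X'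
  ·-cong (~-intro a b c) (~-intro x y z) = +-cong (+-cong (*-cong a x) (*-cong b y)) (*-cong c z)

  inc-resp : ∀ {L L' X X'} → L ~ L' → X ~ X' → Inc p L X → Inc p L' X'
  inc-resp {L} {L'} {X} {X'} L~L' X~X' i = →inc L' X' (≋-trans (≋-sym (·-cong L~L' X~X')) (inc→ L X i))

  ·-comm : ∀ L X → X · L ≡ L · X
  ·-comm (a , b , c) (x , y , z) = swap a b c x y z
    where
    swap : ∀ a b c x y z → (x * a + y * b) + z * c ≡ (a * x + b * y) + c * z
    swap = solve-∀

  inc-sym : ∀ L X → Inc p L X → Inc p X L
  inc-sym L X i = →inc X L (subst (_≋ + 0) (sym (·-comm L X)) (inc→ L X i))

  adjoint-sym : (g : V3 → V3) → (∀ L X → Inc p (g L) X → Inc p L (g X)) →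
    ∀ L X → Inc p L (g X) → Inc p (g L) X
  adjoint-sym g adjoint L X i = inc-sym X (g L) (adjoint X L (inc-sym L (g X) i))

  sameˡ : ∀ {P P' R} → P ~ P' → SamePt p P' R → SamePt p P R
  sameˡ {R = x'' , y'' , z''} (~-intro x y z) (l , l≢0 , s₁ , s₂ , s₃) =
    l , l≢0 , ≋-elim (≋-trans (*-congˡ l x) (≋-intro {b = x''} s₁))
            , ≋-elim (≋-trans (*-congˡ l y) (≋-intro {b = y''} s₂))
            , ≋-elim (≋-trans (*-congˡ l z) (≋-intro {b = z''} s₃))

  sameʳ : ∀ {P R R'} → SamePt p P R → R ~ R' → SamePt p P R'
  sameʳ {x , y , z} (l , l≢0 , s₁ , s₂ , s₃) (~-intro x' y' z') =
    l , l≢0 , ≋-elim (≋-trans (≋-intro {l * x} s₁) x')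
            , ≋-elim (≋-trans (≋-intro {l * y} s₂) y')
            , ≋-elim (≋-trans (≋-intro {l * z} s₃) z')

  exterior-resp : ∀ {C P P'} → P ~ P' → Exterior p C P → Exterior p C P'
  exterior-resp P~P' (L₁ , L₂ , t₁ , t₂ , P∈L₁ , P∈L₂ , L₁≠L₂ , only) =
    L₁ , L₂ , t₁ , t₂ , inc-resp (~-refl L₁) P~P' P∈L₁ , inc-resp (~-refl L₂) P~P' P∈L₂ , L₁≠L₂ ,
    λ L t P'∈L → only L t (inc-resp (~-refl L) (~-sym P~P') P'∈L)

  -- A self-adjoint collineation with self-adjoint inverse: f acts on points,
  -- and, since  f L · X = L · f X, its inverse f⁻¹ acts on lines compatibly
  -- with incidence.
  record Collineation : Set where
    field
      f f⁻¹      : V3 → V3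
      f⁻¹∘f      : ∀ X → f⁻¹ (f X) ~ X
      f∘f⁻¹      : ∀ X → f (f⁻¹ X) ~ X
      f-reflects-pt   : ∀ {X} → IsPt p (f X) → IsPt p X
      f⁻¹-reflects-pt : ∀ {X} → IsPt p (f⁻¹ X) → IsPt p X
      f-same     : ∀ {P Q} → SamePt p P Q → SamePt p (f P) (f Q)
      f⁻¹-same   : ∀ {P Q} → SamePt p P Q → SamePt p (f⁻¹ P) (f⁻¹ Q)
      f-adjoint   : ∀ L X → Inc p (f L) X → Inc p L (f X)
      f⁻¹-adjoint : ∀ L X → Inc p (f⁻¹ L) X → Inc p L (f⁻¹ X)

  inverse : Collineation → Collineation
  inverse φ = record
    { f = f⁻¹ ; f⁻¹ = f ; f⁻¹∘f = f∘f⁻¹ ; f∘f⁻¹ = f⁻¹∘f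
    ; f-reflects-pt = f⁻¹-reflects-pt ; f⁻¹-reflects-pt = f-reflects-pt
    ; f-same = f⁻¹-same ; f⁻¹-same = f-same
    ; f-adjoint = f⁻¹-adjoint ; f⁻¹-adjoint = f-adjoint }
    where open Collineation φ

  record Carries (φ : Collineation) (C C' : Conic) : Set where
    open Collineation φ
    field
      forward  : ∀ {P} → C P → C' (f P)
      backward : ∀ {P} → C' P → C (f⁻¹ P)

  carries-inverse : ∀ {φ C C'} → Carries φ C C' → Carries (inverse φ) C' C
  carries-inverse κ = record { forward = backward ; backward = forward }
    where open Carries κ

  module Transport (φ : Collineation) where
    open Collineation φ

    f-pt : ∀ {X} → IsPt p X → IsPt p (f X)
    f-pt {X} pt = f⁻¹-reflects-pt (isPt-resp (~-sym (f⁻¹∘f X)) pt)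

    f⁻¹-pt : ∀ {X} → IsPt p X → IsPt p (f⁻¹ X)
    f⁻¹-pt {X} pt = f-reflects-pt (isPt-resp (~-sym (f∘f⁻¹ X)) pt)

    inc-image : ∀ {L X} → Inc p L X → Inc p (f⁻¹ L) (f X)
    inc-image {L} {X} i = adjoint-sym f⁻¹ f⁻¹-adjoint L (f X) (inc-resp (~-refl L) (~-sym (f⁻¹∘f X)) i)

    same-transpose : ∀ {P Q} → SamePt p (f P) Q → SamePt p P (f⁻¹ Q)
    same-transpose {P} s = sameˡ (~-sym (f⁻¹∘f P)) (f⁻¹-same s)

    f-reflects-same : ∀ {P Q} → SamePt p (f P) (f Q) → SamePt p P Q
    f-reflects-same {Q = Q} s = sameʳ (same-transpose s) (f⁻¹∘f Q)

    f⁻¹-reflects-same : ∀ {P Q} → SamePt p (f⁻¹ P) (f⁻¹ Q) → SamePt p P Q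
    f⁻¹-reflects-same {P} {Q} s = sameʳ (sameˡ (~-sym (f∘f⁻¹ P)) (f-same s)) (f∘f⁻¹ Q)

    module _ {C C' : Conic} (κ : Carries φ C C') where
      open Carries κ

      -- The image line of a tangent is a tangent: its unique point of contact
      -- P goes to f P, and any other common point Q of f⁻¹ L and C' pulls back
      -- to a common point f⁻¹ Q of L and C.
      tangent-image : ∀ {L} → Tangent p C L → Tangent p C' (f⁻¹ L)
      tangent-image {L} (L-pt , P , P-pt , P∈L , P∈C , unique) =
        f⁻¹-pt L-pt , f P , f-pt P-pt , inc-image P∈L , forward P∈C ,
        λ Q Q-pt Q∈L Q∈C' →
          f⁻¹-reflects-same (sameʳ (unique (f⁻¹ Q) (f⁻¹-pt Q-pt) (f⁻¹-adjoint L Q Q∈L) (backward Q∈C'))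
                                   (~-sym (f⁻¹∘f P)))

  module _ {φ : Collineation} {C C' : Conic} (κ : Carries φ C C') where
    open Collineation φ
    open Transport φ
    private
      tangent-preimage : ∀ {L} → Tangent p C' L → Tangent p C (f L)
      tangent-preimage = Transport.tangent-image (inverse φ) (carries-inverse κ)

    -- The two tangents through an exterior point P map to the two tangents
    -- through f P; a third one would pull back to a third tangent through P.
    exterior-image : ∀ {P} → Exterior p C P → Exterior p C' (f P)
    exterior-image {P} (L₁ , L₂ , t₁ , t₂ , P∈L₁ , P∈L₂ , L₁≠L₂ , only) =
      f⁻¹ L₁ , f⁻¹ L₂ , tangent-image κ t₁ , tangent-image κ t₂ ,
      inc-image P∈L₁ , inc-image P∈L₂ , (λ s → L₁≠L₂ (f⁻¹-reflects-same s)) ,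
      λ L t fP∈L → back L (only (f L) (tangent-preimage t) (adjoint-sym f f-adjoint L P fP∈L))
      where
      back : ∀ L → SamePt p (f L) L₁ ⊎ SamePt p (f L) L₂ → SamePt p L (f⁻¹ L₁) ⊎ SamePt p L (f⁻¹ L₂)
      back L (inj₁ s) = inj₁ (same-transpose s)
      back L (inj₂ s) = inj₂ (same-transpose s)

  module _ {φ : Collineation} {C D C' D' : Conic} (κC : Carries φ C C') (κD : Carries φ D D') where
    open Collineation φ
    open Transport φ

    diamond-image : Diamond p C D → Diamond p C' D'
    diamond-image dia Q Q-pt Q∈D' =
      exterior-resp (f∘f⁻¹ Q)
        (exterior-image κC (dia (f⁻¹ Q) (f⁻¹-pt Q-pt) (Carries.backward κD Q∈D')))

    poncelet-image : ∀ n → HasPoncelet p n C D → HasPoncelet p n C' D'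
    poncelet-image n (B , vertex , distinct , edge) =
      (λ i → f (B i)) ,
      (λ i → f-pt (proj₁ (vertex i)) , Carries.forward κD (proj₂ (vertex i))) ,
      (λ i j i≢j s → distinct i j i≢j (f-reflects-same s)) ,
      λ i j next → edge-image (edge i j next)
      where
      edge-image : ∀ {X Y} → ∃ (λ L → Tangent p C L × Inc p L X × Inc p L Y) →
                   ∃ (λ L → Tangent p C' L × Inc p L (f X) × Inc p L (f Y))
      edge-image (L , t , X∈L , Y∈L) = f⁻¹ L , tangent-image κC t , inc-image X∈L , inc-image Y∈L

  carried-iff : ∀ {φ C D C' D'} n → Carries φ C C' → Carries φ D D' →
    (Diamond p C D × HasPoncelet p n C D) ⇔ (Diamond p C' D' × HasPoncelet p n C' D')
  carried-iff n κC κD = mk⇔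
    (λ (dia , pon) → diamond-image κC κD dia , poncelet-image κC κD n pon)
    (λ (dia , pon) → diamond-image κC⁻¹ κD⁻¹ dia , poncelet-image κC⁻¹ κD⁻¹ n pon)
    where
    κC⁻¹ = carries-inverse κC
    κD⁻¹ = carries-inverse κD

  σ : ℤ → V3 → V3
  σ k (x , y , z) = (x , k * y , k * z)

  σ-symmetric : ∀ k L X → σ k L · X ≡ L · σ k X
  σ-symmetric k (a , b , c) (x , y , z) = symmetric a b c x y z k
    where
    symmetric : ∀ a b c x y z k → (a * x + (k * b) * y) + (k * c) * z ≡ (a * x + b * (k * y)) + c * (k * z)
    symmetric = solve-∀

  σ-adjoint : ∀ k L X → Inc p (σ k L) X → Inc p L (σ k X)
  σ-adjoint k L X i = →inc L (σ k X) (subst (_≋ + 0) (σ-symmetric k L X) (inc→ (σ k L) X i))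

  σ-reflects-pt : ∀ k {X} → IsPt p (σ k X) → IsPt p X
  σ-reflects-pt k {x , y , z} pt (x≡0 , y≡0 , z≡0) =
    pt (x≡0 , ≋-elim (scaled-zero (≋-intro y≡0)) , ≋-elim (scaled-zero (≋-intro z≡0)))
    where
    scaled-zero : ∀ {a} → a ≋ + 0 → k * a ≋ + 0
    scaled-zero a≡0 = ≋-trans (*-congˡ k a≡0) (≋-reflexive (k*0≡0 k))
      where
      k*0≡0 : ∀ k → k * + 0 ≡ + 0
      k*0≡0 = solve-∀

  σ-same : ∀ k {P Q} → SamePt p P Q → SamePt p (σ k P) (σ k Q)
  σ-same k {x , y , z} {x' , y' , z'} (l , l≢0 , s₁ , s₂ , s₃) =
    l , l≢0 , s₁ , ≋-elim (scaled y y' (≋-intro s₂)) , ≋-elim (scaled z z' (≋-intro s₃))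
    where
    commute : ∀ l k a → l * (k * a) ≡ k * (l * a)
    commute = solve-∀
    scaled : ∀ a a' → l * a ≋ a' → l * (k * a) ≋ k * a'
    scaled a a' la≡a' = ≋-trans (≋-reflexive (commute l k a)) (*-congˡ k la≡a')

  σ-cancel : ∀ k l → k * l ≋ + 1 → ∀ X → σ k (σ l X) ~ X
  σ-cancel k l kl≡1 (x , y , z) = ~-intro ≋-refl (cancel y) (cancel z)
    where
    regroup : ∀ k l a → k * (l * a) ≡ (k * l) * a
    regroup = solve-∀
    unit : ∀ a → + 1 * a ≡ a
    unit = solve-∀
    cancel : ∀ a → k * (l * a) ≋ a
    cancel a = ≋-trans (≋-reflexive (regroup k l a)) (≋-trans (*-cong kl≡1 ≋-refl) (≋-reflexive (unit a)))

  scaling : ∀ k l → k * l ≋ + 1 → Collineation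
  scaling k l kl≡1 = record
    { f = σ k ; f⁻¹ = σ l
    ; f⁻¹∘f = σ-cancel l k (≋-trans (≋-reflexive (*-comm l k)) kl≡1) ; f∘f⁻¹ = σ-cancel k l kl≡1
    ; f-reflects-pt = λ {X} → σ-reflects-pt k {X} ; f⁻¹-reflects-pt = λ {X} → σ-reflects-pt l {X}
    ; f-same = λ {P} {Q} → σ-same k {P} {Q} ; f⁻¹-same = λ {P} {Q} → σ-same l {P} {Q}
    ; f-adjoint = σ-adjoint k ; f⁻¹-adjoint = σ-adjoint l }

  form : ℤ → ℤ → V3 → ℤ
  form c m (x , y , z) = (x * x + m * (y * y)) + (c * m) * (z * z)

  O→ : ∀ c m P → O p c m P → form c m P ≋ + 0
  O→ c m (_ , _ , _) o = ≋-intro o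

  →O : ∀ c m P → form c m P ≋ + 0 → O p c m P
  →O c m (_ , _ , _) o = ≋-elim o

  form-σ : ∀ c m k P → form c m (σ k P) ≡ form c ((k * k) * m) P
  form-σ c m k (x , y , z) = rescale c m k x y z
    where
    rescale : ∀ c m k x y z →
      (x * x + m * ((k * y) * (k * y))) + (c * m) * ((k * z) * (k * z))
        ≡ (x * x + ((k * k) * m) * (y * y)) + (c * ((k * k) * m)) * (z * z)
    rescale = solve-∀

  form-cong : ∀ c {m m'} P → m ≋ m' → form c m P ≋ form c m' P
  form-cong c (x , y , z) m≡m' =
    +-cong (+-cong (≋-refl {x * x}) (*-cong m≡m' ≋-refl)) (*-cong (*-congˡ c m≡m') ≋-refl)

  O-σ : ∀ c {m m'} k P → (k * k) * m ≋ m' → O p c m' P → O p c m (σ k P)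
  O-σ c {m} {m'} k P k²m≡m' o =
    →O c m (σ k P) (≋-trans (≋-reflexive (form-σ c m k P))
                   (≋-trans (form-cong c P k²m≡m') (O→ c m' P o)))

  scaling-carries : ∀ c k l m m' (kl≡1 : k * l ≋ + 1) →
    (l * l) * m ≋ m' → Carries (scaling k l kl≡1) (O p c m) (O p c m')
  scaling-carries c k l m m' kl≡1 l²m≡m' = record
    { forward = λ {P} → O-σ c k P k²m'≡m
    ; backward = λ {P} → O-σ c l P l²m≡m' }
    where
    regroup : ∀ k l m → (k * k) * ((l * l) * m) ≡ ((k * l) * (k * l)) * m
    regroup = solve-∀
    unit : ∀ m → (+ 1 * + 1) * m ≡ m
    unit = solve-∀
    k²m'≡m : (k * k) * m' ≋ m
    k²m'≡m = ≋-trans (*-congˡ (k * k) (≋-sym l²m≡m'))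
             (≋-trans (≋-reflexive (regroup k l m))
             (≋-trans (*-cong (*-cong kl≡1 kl≡1) ≋-refl) (≋-reflexive (unit m))))

mainTheorem19 : (p : ℕ) → Prime p → p % 2 ≡ 1 →
    (c : ℤ) → ¬ IsZero p c →
    (p % 4 ≡ 1 → ¬ IsSquare p c) → (p % 4 ≡ 3 → IsSquare p c) →
    (β : ℤ) → ¬ IsZero p β →
    (γ : ℤ) → (β * γ) ≈[ p ] + 1 →
    (n : ℕ) → 3 ≤ n →
    (Diamond p (O p c (+ 1)) (O p c (β * β)) × HasPoncelet p n (O p c (+ 1)) (O p c (β * β)))
      ⇔ (Diamond p (O p c (γ * γ)) (O p c (+ 1)) × HasPoncelet p n (O p c (γ * γ)) (O p c (+ 1)))
mainTheorem19 p _ _ c _ _ _ β _ γ βγ≡1 n _ =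
  carried-iff n (scaling-carries c β γ (+ 1) (γ * γ) βγ≋1 O₁↦O_γ²)
                (scaling-carries c β γ (β * β) (+ 1) βγ≋1 O_β²↦O₁)
  where
  βγ≋1 : β * γ ≋ + 1
  βγ≋1 = ≋-intro βγ≡1
  O₁↦O_γ² : (γ * γ) * + 1 ≋ γ * γ
  O₁↦O_γ² = ≋-reflexive (*-identityʳ (γ * γ))
  regroup : ∀ β γ → (γ * γ) * (β * β) ≡ (β * γ) * (β * γ)
  regroup = solve-∀
  O_β²↦O₁ : (γ * γ) * (β * β) ≋ + 1
  O_β²↦O₁ = ≋-trans (≋-reflexive (regroup β γ)) (*-cong βγ≋1 βγ≋1)
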